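{- Let $G$ be a connected graph containing a set $C$ of vertices inducing a complete subgraph such that $N(v)\setminus C\neq\emptyset$ for every $v\in C$. Then $mh(G)\ge |C|$.
   Context: Hunters and Rabbit game on a graph $G=(V,E)$. A hunter strategy is a finite sequence $(S_1,\dots,S_\ell)$ of non-empty subsets of $V$, using $\max_i|S_i|$ hunters. A rabbit trajectory is a walk $(r_0,\dots,r_\ell)$ in $G$ ($r_i\in N(r_{i-1})$); the strategy is winning if every rabbit trajectory has some $j<\ell$ with $r_j\in S_{j+1}$. Contaminated sets: $Z_0=V$, $Z_i=\{x : \exists y\in Z_{i-1}\setminus S_i,\ xy\in E\}$. A vertex $v$ is cleared at round $i$ if $v\in S_i$, or $N(v)\cap Z_{i-1}\ne\emptyset$ and $N(v)\cap Z_{i-1}\subseteq S_i$. A strategy is monotone if any vertex $v$ cleared at some round $i$ satisfies $v\in S_{j+1}$ whenever $j>i$ and $v\in Z_j$. $mh(G)$ is the minimum number of hunters of a monotone winning hunter strategy ($0$ for a single vertex). -}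

module Defs where

open import Data.Nat using (ℕ; zero; suc; _≤_; _<_; _⊔_)
open import Data.Fin using (Fin)
open import Data.Fin.Subset using (Subset; _∈_; _∉_; ∣_∣; Nonempty)
open import Data.Product using (Σ; ∃; ∃-syntax; _×_)
open import Data.Sum using (_⊎_)
open import Data.Unit using (⊤)
open import Data.Empty using (⊥)
open import Relation.Nullary using (¬_)
open import Relation.Binary.PropositionalEquality using (_≡_)
open import Relation.Binary.Construct.Closure.ReflexiveTransitive using (Star)

record Graph : Set₁ where
  field
    n     : ℕ
    Adj   : Fin n → Fin n → Set
    sym   : ∀ {x y} → Adj x y → Adj y x
    irrefl : ∀ {x} → ¬ Adj x x
open Graph public

Connected : Graph → Set
Connected G = ∀ (x y : Fin (n G)) → Star (Adj G) x y

-- A hunter strategy (S_1, ..., S_ℓ): rounds are indexed 1..ℓ;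
-- the value of sets at 0 and at indices > ℓ is never used.
record Strategy (G : Graph) : Set where
  field
    len      : ℕ
    sets     : ℕ → Subset (n G)
    nonempty : ∀ i → 1 ≤ i → i ≤ len → Nonempty (sets i)
open Strategy public

maxUpTo : ∀ {G} → Strategy G → ℕ → ℕ
maxUpTo σ zero = 0
maxUpTo σ (suc k) = ∣ sets σ (suc k) ∣ ⊔ maxUpTo σ k

hunters : ∀ {G} → Strategy G → ℕ
hunters σ = maxUpTo σ (len σ)

IsWalk : (G : Graph) → ℕ → (ℕ → Fin (n G)) → Set
IsWalk G ℓ r = ∀ i → i < ℓ → Adj G (r i) (r (suc i))

Winning : ∀ {G} → Strategy G → Set
Winning {G} σ = ∀ (r : ℕ → Fin (n G)) → IsWalk G (len σ) r →
  ∃[ j ] (j < len σ × r j ∈ sets σ (suc j))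

Z : ∀ {G} → Strategy G → ℕ → Fin (n G) → Set
Z σ zero x = ⊤
Z {G} σ (suc i) x = ∃[ y ] (Z σ i y × y ∉ sets σ (suc i) × Adj G x y)

ClearedAt : ∀ {G} → Strategy G → ℕ → Fin (n G) → Set
ClearedAt σ zero v = ⊥  -- round 0 does not exist
ClearedAt {G} σ (suc i) v =
  v ∈ sets σ (suc i) ⊎
  ((∃[ w ] (Adj G v w × Z σ i w)) ×
   (∀ w → Adj G v w → Z σ i w → w ∈ sets σ (suc i)))

Monotone : ∀ {G} → Strategy G → Set
Monotone {G} σ = ∀ (v : Fin (n G)) (i j : ℕ) → 1 ≤ i → i ≤ len σ →
  ClearedAt σ i v → i < j → j < len σ → Z σ j v → v ∈ sets σ (suc j)

MhAtLeast : Graph → ℕ → Set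
MhAtLeast G k = ∀ (σ : Strategy G) → Monotone σ → Winning σ → k ≤ hunters σ

IsClique : (G : Graph) → Subset (n G) → Set
IsClique G C = ∀ u v → u ∈ C → v ∈ C → ¬ u ≡ v → Adj G u v

-- Suppose a monotone winning strategy uses fewer than |C| hunters. By induction on the
-- rounds, at most one vertex m of C is clean, and every neighbour of m outside C is
-- contaminated but was cleared earlier, so monotonicity keeps a hunter on it. In each
-- round the hunters therefore cannot cover every contaminated vertex of C: covering C
-- minus m already needs |C| − 1 hunters and m's outside neighbour one more. An
-- uncovered contaminated vertex u of C recontaminates the rest of the clique, so again
-- only u can be clean afterwards. At the end of a winning strategy all of C is clean,
-- hence |C| ≤ 1, while a winning strategy uses at least one hunter.
module Submission where

open import Defs
open import Data.Nat using (_≤_)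
open import Data.Fin.Subset using (Subset; _∈_; _∉_; ∣_∣)
open import Data.Product using (∃-syntax; _×_)

open import Data.Nat using (ℕ; zero; suc; _<_; z≤n; s≤s; _≤?_)
open import Data.Nat.Properties
  using (≤-refl; ≤-trans; ≤-pred; ≤-<-trans; <⇒≤; <⇒≱; ≮⇒≥; n≤1+n; m≤m⊔n; m≤n⇒m≤o⊔n;
         m≤n⇒m<n∨m≡n; m≤n+m)
open import Data.Fin using (Fin; zero; suc)
open import Data.Fin.Properties using (_≟_; any?)
open import Data.Fin.Subset using (_-_; _─_; ⁅_⁆; _⊆_; _⊂_; inside; outside; Nonempty)
open import Data.Fin.Subset.Properties
  using (_∈?_; p─⊥≡p; p─q⊆p; x∈p∧x≢y⇒x∈p-y; p⊂q⇒∣p∣<∣q∣; x∈p⇒∣p-x∣<∣p∣;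
         p⊆q⇒∣p∣≤∣q∣; x∈⁅x⁆; ∣⁅x⁆∣≡1)
open import Data.Product using (_,_; proj₁; proj₂)
open import Data.Sum using (inj₁; inj₂)
open import Data.Empty using (⊥; ⊥-elim)
open import Data.Unit using (tt)
open import Data.Vec using (_∷_; here; there)
open import Function using (case_of_)
open import Relation.Binary using (Decidable)
open import Relation.Nullary using (¬_; Dec; yes; no; ¬?; _×-dec_)
open import Relation.Nullary.Decidable using (decidable-stable; ¬¬-excluded-middle)
open import Relation.Nullary.Negation using (¬¬-map)
open import Relation.Binary.PropositionalEquality
  using (_≡_; _≢_; refl; subst; subst₂; trans) renaming (sym to ≡-sym)

¬¬-∀-Fin : ∀ {n} {P : Fin n → Set} → (∀ i → ¬ ¬ P i) → ¬ ¬ (∀ i → P i)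
¬¬-∀-Fin {zero}  _   k = k λ ()
¬¬-∀-Fin {suc n} ¬¬P k = ¬¬P zero λ P₀ → ¬¬-∀-Fin (λ i → ¬¬P (suc i)) λ Pₛ →
  k λ { zero → P₀ ; (suc i) → Pₛ i }

¬¬-decidable-Adj : (G : Graph) → ¬ ¬ Decidable (Adj G)
¬¬-decidable-Adj G = ¬¬-∀-Fin λ x → ¬¬-∀-Fin λ y → ¬¬-excluded-middle

∣p∣≤1+∣p-x∣ : ∀ {k} (p : Subset k) x → ∣ p ∣ ≤ suc ∣ p - x ∣
∣p∣≤1+∣p-x∣ (inside  ∷ p) zero    = subst (λ t → suc ∣ p ∣ ≤ suc ∣ t ∣) (≡-sym (p─⊥≡p p)) ≤-refl
∣p∣≤1+∣p-x∣ (outside ∷ p) zero    = subst (λ t → ∣ p ∣ ≤ suc ∣ t ∣) (≡-sym (p─⊥≡p p)) (n≤1+n _)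
∣p∣≤1+∣p-x∣ (inside  ∷ p) (suc x) = s≤s (∣p∣≤1+∣p-x∣ p x)
∣p∣≤1+∣p-x∣ (outside ∷ p) (suc x) = ∣p∣≤1+∣p-x∣ p x

x∈p─q⇒x∉q : ∀ {k} {x : Fin k} (p q : Subset k) → x ∈ p ─ q → x ∉ q
x∈p─q⇒x∉q (_ ∷ p) (.inside ∷ q) () here
x∈p─q⇒x∉q (_ ∷ p) (_ ∷ q) (there x∈p─q) (there x∈q) = x∈p─q⇒x∉q p q x∈p─q x∈q

x∈p-y⇒x≢y : ∀ {k} {x y : Fin k} {p : Subset k} → x ∈ p - y → x ≢ y
x∈p-y⇒x≢y {y = y} {p} x∈p-y refl = x∈p─q⇒x∉q p ⁅ y ⁆ x∈p-y (x∈⁅x⁆ y)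

x∈p-y⇒x∈p : ∀ {k} {x y : Fin k} {p : Subset k} → x ∈ p - y → x ∈ p
x∈p-y⇒x∈p {y = y} {p} = p─q⊆p p ⁅ y ⁆

0<∣p∣⇒Nonempty : ∀ {k} (p : Subset k) → 0 < ∣ p ∣ → Nonempty p
0<∣p∣⇒Nonempty (inside  ∷ p) _ = zero , here
0<∣p∣⇒Nonempty (outside ∷ p) 0<∣p∣ with 0<∣p∣⇒Nonempty p 0<∣p∣
... | x , x∈p = suc x , there x∈p

p⊆⁅x⁆⇒∣p∣≤1 : ∀ {k} {p : Subset k} {x} → p ⊆ ⁅ x ⁆ → ∣ p ∣ ≤ 1
p⊆⁅x⁆⇒∣p∣≤1 {x = x} p⊆⁅x⁆ = subst (_ ≤_) (∣⁅x⁆∣≡1 x) (p⊆q⇒∣p∣≤∣q∣ p⊆⁅x⁆)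

p-x⊂q⇒∣p∣≤∣q∣ : ∀ {k} {p q : Subset k} {x} → p - x ⊂ q → ∣ p ∣ ≤ ∣ q ∣
p-x⊂q⇒∣p∣≤∣q∣ {p = p} {x = x} p-x⊂q = ≤-trans (∣p∣≤1+∣p-x∣ p x) (p⊂q⇒∣p∣<∣q∣ p-x⊂q)

p-x-y⊂q-z⇒∣p∣≤∣q∣ : ∀ {k} {p q : Subset k} {x y z} → z ∈ q → p - x - y ⊂ q - z → ∣ p ∣ ≤ ∣ q ∣
p-x-y⊂q-z⇒∣p∣≤∣q∣ {p = p} {x = x} z∈q p-x-y⊂q-z =
  ≤-trans (∣p∣≤1+∣p-x∣ p x) (≤-trans (s≤s (p-x⊂q⇒∣p∣≤∣q∣ p-x-y⊂q-z)) (x∈p⇒∣p-x∣<∣p∣ z∈q))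

module _ {G : Graph} (σ : Strategy G) where

  ∣sets∣≤maxUpTo : ∀ m i → 1 ≤ i → i ≤ m → ∣ sets σ i ∣ ≤ maxUpTo σ m
  ∣sets∣≤maxUpTo zero    _ (s≤s _) ()
  ∣sets∣≤maxUpTo (suc m) i 1≤i i≤1+m with m≤n⇒m<n∨m≡n i≤1+m
  ... | inj₁ i≤m  = m≤n⇒m≤o⊔n ∣ sets σ (suc m) ∣ (∣sets∣≤maxUpTo m i 1≤i (≤-pred i≤m))
  ... | inj₂ refl = m≤m⊔n _ _

  ∣sets∣≤hunters : ∀ {i} → 1 ≤ i → i ≤ len σ → ∣ sets σ i ∣ ≤ hunters σ
  ∣sets∣≤hunters = ∣sets∣≤maxUpTo (len σ) _

  Z? : Decidable (Adj G) → ∀ i x → Dec (Z σ i x)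
  Z? adj? zero    x = yes tt
  Z? adj? (suc i) x = any? λ y → Z? adj? i y ×-dec ¬? (y ∈? sets σ (suc i)) ×-dec adj? x y

  clean⇒contaminated-neighbours-hunted : ∀ {j x y} → ¬ Z σ (suc j) x → Adj G x y → Z σ j y →
    y ∈ sets σ (suc j)
  clean⇒contaminated-neighbours-hunted {j} {y = y} x-clean x~y y∈Z =
    decidable-stable (y ∈? sets σ (suc j)) λ y∉S → x-clean (y , y∈Z , y∉S , x~y)

  clean-next-to-contaminated⇒cleared : ∀ {j x y} → ¬ Z σ (suc j) x → Adj G x y → Z σ j y →
    ClearedAt σ (suc j) x
  clean-next-to-contaminated⇒cleared x-clean x~y y∈Z =
    inj₂ ((_ , x~y , y∈Z) , λ _ → clean⇒contaminated-neighbours-hunted x-clean)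

  ClearedBefore : ℕ → Fin (n G) → Set
  ClearedBefore j v = ∃[ i ] (1 ≤ i × i < j × ClearedAt σ i v)

  ClearedBefore-mono : ∀ {j k v} → j ≤ k → ClearedBefore j v → ClearedBefore k v
  ClearedBefore-mono j≤k (i , 1≤i , i<j , cleared) = i , 1≤i , ≤-trans i<j j≤k , cleared

  monotone⇒hunted : Monotone σ → ∀ {j v} → j < len σ → ClearedBefore j v → Z σ j v →
    v ∈ sets σ (suc j)
  monotone⇒hunted monotone j<ℓ (i , 1≤i , i<j , cleared) =
    monotone _ i _ 1≤i (≤-trans (<⇒≤ i<j) (<⇒≤ j<ℓ)) cleared i<j j<ℓ

snoc : {A : Set} → (ℕ → A) → ℕ → A → ℕ → A
snoc r j x i with i ≤? j
... | yes _ = r i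
... | no  _ = x

snoc-≤ : ∀ {A : Set} (r : ℕ → A) {j} x {i} → i ≤ j → snoc r j x i ≡ r i
snoc-≤ r {j} x {i} i≤j with i ≤? j
... | yes _   = refl
... | no  i≰j = ⊥-elim (i≰j i≤j)

snoc-suc : ∀ {A : Set} (r : ℕ → A) j x → snoc r j x (suc j) ≡ x
snoc-suc r j x with suc j ≤? j
... | yes 1+j≤j = ⊥-elim (<⇒≱ 1+j≤j ≤-refl)
... | no  _     = refl

EvadingWalk : ∀ {G} → Strategy G → ℕ → Fin (n G) → Set
EvadingWalk {G} σ j x = ∃[ r ] (r j ≡ x × IsWalk G j r × (∀ i → i < j → r i ∉ sets σ (suc i)))

contaminated⇒EvadingWalk : ∀ {G} (σ : Strategy G) j x → Z σ j x → EvadingWalk σ j x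
contaminated⇒EvadingWalk σ zero x _ = (λ _ → x) , refl , (λ _ ()) , (λ _ ())
contaminated⇒EvadingWalk {G} σ (suc j) x (y , y∈Z , y∉S , x~y)
  with contaminated⇒EvadingWalk σ j y y∈Z
... | r , rj≡y , walk , evades = r′ , snoc-suc r j x , walk′ , evades′
  where
  r′ : ℕ → Fin (n G)
  r′ = snoc r j x

  r′j≡y : r′ j ≡ y
  r′j≡y = trans (snoc-≤ r x ≤-refl) rj≡y

  walk′ : IsWalk G (suc j) r′
  walk′ i i<1+j with m≤n⇒m<n∨m≡n (≤-pred i<1+j)
  ... | inj₁ i<j  =
    subst₂ (Adj G) (≡-sym (snoc-≤ r x (<⇒≤ i<j))) (≡-sym (snoc-≤ r x i<j)) (walk i i<j)
  ... | inj₂ refl = subst₂ (Adj G) (≡-sym r′j≡y) (≡-sym (snoc-suc r j x)) (Graph.sym G x~y)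

  evades′ : ∀ i → i < suc j → r′ i ∉ sets σ (suc i)
  evades′ i i<1+j with m≤n⇒m<n∨m≡n (≤-pred i<1+j)
  ... | inj₁ i<j  = subst (_∉ sets σ (suc i)) (≡-sym (snoc-≤ r x (<⇒≤ i<j))) (evades i i<j)
  ... | inj₂ refl = subst (_∉ sets σ (suc j)) (≡-sym r′j≡y) y∉S

winning⇒clean-at-end : ∀ {G} (σ : Strategy G) → Winning σ → ∀ x → ¬ Z σ (len σ) x
winning⇒clean-at-end σ winning x x∈Z with contaminated⇒EvadingWalk σ (len σ) x x∈Z
... | r , _ , walk , evades with winning r walk
... | j , j<ℓ , hit = evades j j<ℓ hit

winning⇒len-positive : ∀ {G} (σ : Strategy G) → Fin (n G) → Winning σ → 1 ≤ len σ
winning⇒len-positive σ x winning with len σ | winning (λ _ → x)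
... | zero  | stay = case stay (λ _ ()) of λ { (_ , () , _) }
... | suc _ | _    = s≤s z≤n

winning⇒hunters-positive : ∀ {G} (σ : Strategy G) → Fin (n G) → Winning σ → 1 ≤ hunters σ
winning⇒hunters-positive σ x winning with winning⇒len-positive σ x winning
... | 1≤ℓ with nonempty σ 1 ≤-refl 1≤ℓ
...   | y , y∈S₁ = ≤-trans (≤-<-trans z≤n (x∈p⇒∣p-x∣<∣p∣ y∈S₁)) (∣sets∣≤hunters σ ≤-refl 1≤ℓ)

module FewHunters
  (G : Graph) (adj? : Decidable (Adj G))
  (C : Subset (n G)) (clique : IsClique G C)
  (exit : ∀ v → v ∈ C → ∃[ w ] (Adj G v w × w ∉ C))
  (σ : Strategy G) (monotone : Monotone σ) (few : hunters σ < ∣ C ∣)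
  where

  -- the hunters of round j + 1, the ones that meet the rabbit's position r_j
  S : ℕ → Subset (n G)
  S j = sets σ (suc j)

  Clean : ℕ → Fin (n G) → Set
  Clean j x = ¬ Z σ j x

  record Invariant (j : ℕ) : Set where
    field
      clean-unique : ∀ {x y} → x ∈ C → y ∈ C → Clean j x → Clean j y → x ≡ y
      exits-of-clean-guarded : ∀ {v w} → v ∈ C → Clean j v → Adj G v w → w ∉ C →
        Z σ j w × ClearedBefore σ j w
      clean-exits-cleared : ∀ {y w} → y ∈ C → Adj G y w → w ∉ C → Clean j w →
        ClearedBefore σ (suc j) w
  open Invariant

  invariant-zero : Invariant 0
  invariant-zero = record
    { clean-unique           = λ _ _ x-clean _ → ⊥-elim (x-clean tt)
    ; exits-of-clean-guarded = λ _ v-clean _ _ → ⊥-elim (v-clean tt)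
    ; clean-exits-cleared    = λ _ _ _ w-clean → ⊥-elim (w-clean tt)
    }

  module Round (j : ℕ) (j<ℓ : j < len σ) (I : Invariant j) where

    overfull : ∣ C ∣ ≤ ∣ S j ∣ → ⊥
    overfull = <⇒≱ (≤-<-trans (∣sets∣≤hunters σ (s≤s z≤n) j<ℓ) few)

    one-extra-hunter : ∀ {y w} → (∀ {x} → x ∈ C → x ≢ y → x ∈ S j) → w ∈ S j → w ∉ C → ⊥
    one-extra-hunter covers w∈S w∉C = overfull (p-x⊂q⇒∣p∣≤∣q∣
      ( (λ x∈C-y → covers (x∈p-y⇒x∈p x∈C-y) (x∈p-y⇒x≢y x∈C-y))
      , _ , w∈S , λ w∈C-y → w∉C (x∈p-y⇒x∈p w∈C-y)))

    two-extra-hunters : ∀ {y₁ y₂ w₁ w₂} → (∀ {x} → x ∈ C → x ≢ y₁ → x ≢ y₂ → x ∈ S j) →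
      w₁ ∈ S j → w₁ ∉ C → w₂ ∈ S j → w₂ ∉ C → w₂ ≢ w₁ → ⊥
    two-extra-hunters {y₁} {y₂} {w₁} {w₂} covers w₁∈S w₁∉C w₂∈S w₂∉C w₂≢w₁ =
      overfull (p-x-y⊂q-z⇒∣p∣≤∣q∣ w₁∈S (C-y₁-y₂⊆S-w₁ , w₂ , x∈p∧x≢y⇒x∈p-y w₂∈S w₂≢w₁ , w₂∉C-y₁-y₂))
      where
      C-y₁-y₂⊆S-w₁ : C - y₁ - y₂ ⊆ S j - w₁
      C-y₁-y₂⊆S-w₁ x∈C-y₁-y₂ =
        let x∈C-y₁ = x∈p-y⇒x∈p x∈C-y₁-y₂
            x∈C    = x∈p-y⇒x∈p x∈C-y₁
        in x∈p∧x≢y⇒x∈p-y (covers x∈C (x∈p-y⇒x≢y x∈C-y₁) (x∈p-y⇒x≢y x∈C-y₁-y₂))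
                         λ { refl → w₁∉C x∈C }

      w₂∉C-y₁-y₂ : w₂ ∉ C - y₁ - y₂
      w₂∉C-y₁-y₂ w₂∈C-y₁-y₂ = w₂∉C (x∈p-y⇒x∈p (x∈p-y⇒x∈p w₂∈C-y₁-y₂))

    data CleanMembers : Set where
      none-clean : (∀ {x} → x ∈ C → Z σ j x) → CleanMembers
      one-clean  : ∀ {m} → m ∈ C → Clean j m → CleanMembers

    clean-members : CleanMembers
    clean-members with any? (λ m → m ∈? C ×-dec ¬? (Z? σ adj? j m))
    ... | yes (m , m∈C , m-clean) = one-clean m∈C m-clean
    ... | no  no-clean = none-clean λ {x} x∈C →
      decidable-stable (Z? σ adj? j x) λ x-clean → no-clean (x , x∈C , x-clean)

    others-contaminated : ∀ {m x} → m ∈ C → Clean j m → x ∈ C → x ≢ m → Z σ j x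
    others-contaminated m∈C m-clean x∈C x≢m =
      decidable-stable (Z? σ adj? j _) λ x-clean → x≢m (clean-unique I x∈C m∈C x-clean m-clean)

    exit-of-clean-hunted : ∀ {m w} → m ∈ C → Clean j m → Adj G m w → w ∉ C → w ∈ S j
    exit-of-clean-hunted m∈C m-clean m~w w∉C with exits-of-clean-guarded I m∈C m-clean m~w w∉C
    ... | w∈Z , guarded = monotone⇒hunted σ monotone j<ℓ guarded w∈Z

    contaminated-members-not-all-hunted : ¬ (∀ {z} → z ∈ C → Z σ j z → z ∈ S j)
    contaminated-members-not-all-hunted hunted with clean-members
    ... | none-clean contaminated = overfull (p⊆q⇒∣p∣≤∣q∣ λ x∈C → hunted x∈C (contaminated x∈C))
    ... | one-clean {m} m∈C m-clean with exit m m∈C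
    ...   | w , m~w , w∉C = one-extra-hunter
              (λ x∈C x≢m → hunted x∈C (others-contaminated m∈C m-clean x∈C x≢m))
              (exit-of-clean-hunted m∈C m-clean m~w w∉C) w∉C

    unhunted-member : ∃[ u ] (u ∈ C × Z σ j u × u ∉ S j)
    unhunted-member with any? (λ u → u ∈? C ×-dec Z? σ adj? j u ×-dec ¬? (u ∈? S j))
    ... | yes found = found
    ... | no  none  = ⊥-elim (contaminated-members-not-all-hunted λ {z} z∈C z∈Z →
            decidable-stable (z ∈? S j) λ z∉S → none (z , z∈C , z∈Z , z∉S))

    u : Fin (n G)
    u = proj₁ unhunted-member

    u∈C : u ∈ C
    u∈C = proj₁ (proj₂ unhunted-member)

    u-contaminated : Z σ j u
    u-contaminated = proj₁ (proj₂ (proj₂ unhunted-member))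

    u∉S : u ∉ S j
    u∉S = proj₂ (proj₂ (proj₂ unhunted-member))

    clean-next⇒≡u : ∀ {v} → v ∈ C → Clean (suc j) v → v ≡ u
    clean-next⇒≡u {v} v∈C v-clean with v ≟ u
    ... | yes v≡u = v≡u
    ... | no  v≢u = ⊥-elim (v-clean (u , u-contaminated , u∉S , clique v u v∈C u∈C v≢u))

    u-clean-next⇒members-hunted : Clean (suc j) u → ∀ {x} → x ∈ C → x ≢ u → Z σ j x → x ∈ S j
    u-clean-next⇒members-hunted u-clean x∈C x≢u =
      clean⇒contaminated-neighbours-hunted σ u-clean (clique u _ u∈C x∈C λ u≡x → x≢u (≡-sym u≡x))

    exit-of-u-guarded : Clean (suc j) u → ∀ {w} → Adj G u w → w ∉ C → ClearedBefore σ (suc j) w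
    exit-of-u-guarded u-clean {w} u~w w∉C with Z? σ adj? j w
    ... | no  w-clean = clean-exits-cleared I u∈C u~w w∉C w-clean
    ... | yes w∈Z with clean-members
    ...   | none-clean contaminated = ⊥-elim (one-extra-hunter
              (λ x∈C x≢u → hunted x∈C x≢u (contaminated x∈C)) w∈S w∉C)
      where hunted = u-clean-next⇒members-hunted u-clean
            w∈S = clean⇒contaminated-neighbours-hunted σ u-clean u~w w∈Z
    ...   | one-clean {m} m∈C m-clean with adj? m w | exit m m∈C
    ...     | yes m~w | _ =
              ClearedBefore-mono σ (n≤1+n j) (proj₂ (exits-of-clean-guarded I m∈C m-clean m~w w∉C))
    ...     | no ¬m~w | w₀ , m~w₀ , w₀∉C = ⊥-elim (two-extra-hunters
              (λ x∈C x≢m x≢u → u-clean-next⇒members-hunted u-clean x∈C x≢u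
                 (others-contaminated m∈C m-clean x∈C x≢m))
              (exit-of-clean-hunted m∈C m-clean m~w₀ w₀∉C) w₀∉C
              (clean⇒contaminated-neighbours-hunted σ u-clean u~w w∈Z) w∉C
              λ { refl → ¬m~w m~w₀ })

    exits-of-clean-guarded′ : ∀ {v w} → v ∈ C → Clean (suc j) v → Adj G v w → w ∉ C →
      Z σ (suc j) w × ClearedBefore σ (suc j) w
    exits-of-clean-guarded′ v∈C v-clean v~w w∉C with clean-next⇒≡u v∈C v-clean
    ... | refl = (u , u-contaminated , u∉S , Graph.sym G v~w) , exit-of-u-guarded v-clean v~w w∉C

    clean-exits-cleared′ : ∀ {y w} → y ∈ C → Adj G y w → w ∉ C → Clean (suc j) w →
      ClearedBefore σ (suc (suc j)) w
    clean-exits-cleared′ {y} y∈C y~w w∉C w-clean with Z? σ adj? j y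
    ... | yes y∈Z    =
      suc j , s≤s z≤n , ≤-refl , clean-next-to-contaminated⇒cleared σ w-clean (Graph.sym G y~w) y∈Z
    ... | no y-clean =
      ClearedBefore-mono σ (m≤n+m j 2) (proj₂ (exits-of-clean-guarded I y∈C y-clean y~w w∉C))

    next : Invariant (suc j)
    next = record
      { clean-unique           = λ x∈C y∈C x-clean y-clean →
          trans (clean-next⇒≡u x∈C x-clean) (≡-sym (clean-next⇒≡u y∈C y-clean))
      ; exits-of-clean-guarded = exits-of-clean-guarded′
      ; clean-exits-cleared    = clean-exits-cleared′
      }

  invariant : ∀ j → j ≤ len σ → Invariant j
  invariant zero    _     = invariant-zero
  invariant (suc j) 1+j≤ℓ = Round.next j 1+j≤ℓ (invariant j (≤-trans (n≤1+n j) 1+j≤ℓ))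

  not-winning : ¬ Winning σ
  not-winning winning with 0<∣p∣⇒Nonempty C (≤-<-trans z≤n few)
  ... | x₀ , x₀∈C = <⇒≱ (≤-<-trans (winning⇒hunters-positive σ x₀ winning) few) ∣C∣≤1
    where
    clean : ∀ x → ¬ Z σ (len σ) x
    clean = winning⇒clean-at-end σ winning

    ∣C∣≤1 : ∣ C ∣ ≤ 1
    ∣C∣≤1 = p⊆⁅x⁆⇒∣p∣≤1 λ {x} x∈C →
      subst (_∈ ⁅ x₀ ⁆)
            (≡-sym (clean-unique (invariant (len σ) ≤-refl) x∈C x₀∈C (clean x) (clean x₀)))
            (x∈⁅x⁆ x₀)

-- Adjacency is an arbitrary relation, so contamination is
-- decidable only once adjacency is; as the conclusion is decidable, that may be assumed
-- under a double negation.
lemma4p5 : (G : Graph) → Connected G → (C : Subset (n G)) → IsClique G C →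
    (∀ v → v ∈ C → ∃[ w ] (Adj G v w × w ∉ C)) →
    MhAtLeast G ∣ C ∣
lemma4p5 G _ C clique exit σ monotone winning =
  decidable-stable (∣ C ∣ ≤? hunters σ) (¬¬-map
    (λ adj? → ≮⇒≥ λ few → FewHunters.not-winning G adj? C clique exit σ monotone few winning)
    (¬¬-decidable-Adj G))
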